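{- Let $s\ge 1$, $L\ge 2s^3+5s^2+1$, $L\le k\le s+L$ and $n\ge 2s^5+8s^4+s^3-14s^2+3s+1$ be integers. There is an injection $\phi_3:C^3_{L,s,2}(n)\to F^3_{L,s,k}(n)$.
   Context: $C_{L,s,2}(n)$ is the set of partitions of $n$ with all parts in $\{s+1,\ldots,s+L\}$; for such a partition, $f_i$ denotes the number of parts equal to $i$. $F_{L,s,k}(n)$ is the set of partitions of $n$ with smallest part equal to $s$, largest part at most $s+L$, and no part equal to $k$; for such a partition, $g_i$ denotes the number of parts equal to $i$. $C^3_{L,s,2}(n)$ is the set of partitions in $C_{L,s,2}(n)$ with $f_k=0$, $f_{as}=0$ for all integers $a\ge 2$, and $f_j\le s-1$ for every integer $j$ with $s+1\le j\le 2s^2+5s-1$. $F^3_{L,s,k}(n)$ is the set of partitions in $F_{L,s,k}(n)$ with $g_s=1$ and $g_{2s}+g_{3s}\ge 2$. -}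

module Defs where

open import Data.Nat using (ℕ; zero; suc; _+_; _*_; _∸_; _^_; _≤_; _<_; _≥_; _≟_)
open import Data.List using (List; []; _∷_)
open import Data.Nat.ListAction using (sum)
open import Data.List.Relation.Unary.All using (All)
open import Data.List.Relation.Unary.Linked using (Linked)
open import Data.List.Membership.Propositional using (_∈_)
open import Data.Product using (Σ; _×_; proj₁)
open import Relation.Nullary using (yes; no)
open import Relation.Binary.PropositionalEquality using (_≡_)

IsPartition : ℕ → List ℕ → Set
IsPartition n ps = Linked _≥_ ps × All (1 ≤_) ps × sum ps ≡ n

Partition : ℕ → Set
Partition n = Σ (List ℕ) (IsPartition n)

mult : ℕ → List ℕ → ℕ
mult i [] = 0
mult i (p ∷ ps) with p ≟ i
... | yes _ = suc (mult i ps)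
... | no _ = mult i ps

InC : ℕ → ℕ → List ℕ → Set
InC L s ps = All (λ p → suc s ≤ p × p ≤ s + L) ps

InC3 : ℕ → ℕ → ℕ → List ℕ → Set
InC3 L s k ps =
  InC L s ps
  × mult k ps ≡ 0
  × (∀ a → 2 ≤ a → mult (a * s) ps ≡ 0)
  × (∀ j → suc s ≤ j → j ≤ (2 * s ^ 2 + 5 * s) ∸ 1 → mult j ps ≤ s ∸ 1)

C3 : ℕ → ℕ → ℕ → ℕ → Set
C3 L s k n = Σ (List ℕ) (λ ps → IsPartition n ps × InC3 L s k ps)

InF : ℕ → ℕ → ℕ → List ℕ → Set
InF L s k ps = s ∈ ps × All (λ p → s ≤ p × p ≤ s + L) ps × mult k ps ≡ 0

InF3 : ℕ → ℕ → ℕ → List ℕ → Set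
InF3 L s k ps = InF L s k ps × mult s ps ≡ 1 × 2 ≤ mult (2 * s) ps + mult (3 * s) ps

F3 : ℕ → ℕ → ℕ → ℕ → Set
F3 L s k n = Σ (List ℕ) (λ ps → IsPartition n ps × InF3 L s k ps)

-- an injection between sets of partitions (identified by their list of parts)
Injection : {A B : Set} → (A → List ℕ) → (B → List ℕ) → Set
Injection {A} {B} ua ub =
  Σ (A → B) (λ φ → ∀ x y → ub (φ x) ≡ ub (φ y) → ua x ≡ ua y)

module Submission where

-- Write s = t + 1 and N = 2s² + 5s.  A partition in C³ has at most s − 1 copies of
-- each part in (s, N), so if all its parts were below N its size would be at most
-- (s − 1)·((s + 1) + ⋯ + (N − 1)) = 2s⁵ + 8s⁴ + s³ − 14s² + 3s < n.  Hence its largest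
-- part p is at least N.  No part is a multiple a·s with a ≥ 2, so p = r + q·s with
-- 1 ≤ r < s and q ≥ 2s + 5, and therefore
--     p = s + (s + 1)·x + (m + 4)·s,   x = s + r ∈ (s, 2s),   m = q − (6 + s + r).
-- φ₃ replaces p by one part s, s + 1 copies of x and m + 4 units of s packed into
-- parts 2s and 3s (at least two of them), and sorts the result; this lands in F³.
-- It is injective: x is the only value that can occur s + 1 times in the image, the
-- remainder (which avoids s, 2s and 3s) is then recovered from the multiplicities,
-- and p from the total n.

open import Defs
open import Data.Nat using (ℕ; zero; suc; _+_; _*_; _∸_; _^_; _≤_; _<_; _≥_; _≟_; _≤?_; z≤n; s≤s)
open import Data.Nat.Properties
open import Data.Nat.DivMod using (_/_; _%_; m%n<n; m≡m%n+[m/n]*n)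
open import Data.Nat.Tactic.RingSolver using (solve-∀)
open import Data.Nat.ListAction using (sum)
open import Data.Nat.ListAction.Properties using (sum-↭; sum-++)
open import Data.List using (List; []; _∷_; _++_; replicate; length)
open import Data.List.Relation.Unary.All as All using (All; []; _∷_)
open import Data.List.Relation.Unary.All.Properties using (++⁺; replicate⁺)
open import Data.List.Relation.Unary.Any using (here; there)
open import Data.List.Relation.Unary.Linked as Linked using (Linked)
open import Data.List.Relation.Unary.Linked.Properties using (Linked⇒All)
open import Data.List.Membership.Propositional using (_∈_)
open import Data.List.Relation.Binary.Permutation.Propositional as ↭ using (_↭_; ↭-sym)
open import Data.List.Relation.Binary.Permutation.Propositional.Properties using (All-resp-↭)
open import Relation.Binary.Properties.DecTotalOrder ≤-decTotalOrder using (≥-decTotalOrder)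
open import Data.List.Sort ≥-decTotalOrder using (sort; sort-↭; sort-↗)
open import Data.Product using (_×_; _,_; proj₁; proj₂)
open import Data.Sum using (_⊎_; inj₁; inj₂; [_,_])
open import Data.Empty using (⊥; ⊥-elim)
open import Relation.Nullary using (Dec; yes; no; ¬_; contradiction)
open import Relation.Nullary.Decidable using (_⊎-dec_)
open import Relation.Binary.PropositionalEquality using (_≡_; _≢_; refl; sym; trans; cong; cong₂; subst; module ≡-Reasoning)

mult-here : ∀ i xs → mult i (i ∷ xs) ≡ suc (mult i xs)
mult-here i xs with i ≟ i
... | yes _ = refl
... | no i≢i = contradiction refl i≢i

mult-there : ∀ {i x} xs → x ≢ i → mult i (x ∷ xs) ≡ mult i xs
mult-there {i} {x} xs x≢i with x ≟ i
... | yes x≡i = contradiction x≡i x≢i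
... | no _ = refl

mult-∷-≤ : ∀ i x xs → mult i xs ≤ mult i (x ∷ xs)
mult-∷-≤ i x xs with x ≟ i
... | yes _ = n≤1+n _
... | no _ = ≤-refl

mult-zero-tail : ∀ {i} x xs → mult i (x ∷ xs) ≡ 0 → mult i xs ≡ 0
mult-zero-tail {i} x xs none = n≤0⇒n≡0 (≤-trans (mult-∷-≤ i x xs) (≤-reflexive none))

mult-zero-head : ∀ {i x} xs → mult i (x ∷ xs) ≡ 0 → x ≢ i
mult-zero-head {i} xs none refl = 0≢1+n (trans (sym none) (mult-here i xs))

mult-++ : ∀ i xs ys → mult i (xs ++ ys) ≡ mult i xs + mult i ys
mult-++ i [] ys = refl
mult-++ i (x ∷ xs) ys with x ≟ i
... | yes _ = cong suc (mult-++ i xs ys)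
... | no _ = mult-++ i xs ys

mult-↭ : ∀ i {xs ys} → xs ↭ ys → mult i xs ≡ mult i ys
mult-↭ i ↭.refl = refl
mult-↭ i (↭.prep {xs = xs} {ys = ys} x p) = begin
  mult i ((x ∷ []) ++ xs)       ≡⟨ mult-++ i (x ∷ []) xs ⟩
  mult i (x ∷ []) + mult i xs   ≡⟨ cong (mult i (x ∷ []) +_) (mult-↭ i p) ⟩
  mult i (x ∷ []) + mult i ys   ≡⟨ mult-++ i (x ∷ []) ys ⟨
  mult i ((x ∷ []) ++ ys)       ∎
  where open ≡-Reasoning
mult-↭ i (↭.swap {xs = xs} {ys = ys} x y p) = begin
  mult i ((x ∷ y ∷ []) ++ xs)       ≡⟨ mult-++ i (x ∷ y ∷ []) xs ⟩
  mult i (x ∷ y ∷ []) + mult i xs   ≡⟨ cong₂ _+_ pair-comm (mult-↭ i p) ⟩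
  mult i (y ∷ x ∷ []) + mult i ys   ≡⟨ mult-++ i (y ∷ x ∷ []) ys ⟨
  mult i ((y ∷ x ∷ []) ++ ys)       ∎
  where
  open ≡-Reasoning
  pair-comm : mult i (x ∷ y ∷ []) ≡ mult i (y ∷ x ∷ [])
  pair-comm = trans (mult-++ i (x ∷ []) (y ∷ []))
                (trans (+-comm (mult i (x ∷ [])) _) (sym (mult-++ i (y ∷ []) (x ∷ []))))
mult-↭ i (↭.trans p q) = trans (mult-↭ i p) (mult-↭ i q)

mult-replicate : ∀ c x → mult x (replicate c x) ≡ c
mult-replicate zero x = refl
mult-replicate (suc c) x = trans (mult-here x _) (cong suc (mult-replicate c x))

mult-outside : ∀ {P : ℕ → Set} {i} xs → All P xs → ¬ P i → mult i xs ≡ 0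
mult-outside [] [] _ = refl
mult-outside {i = i} (x ∷ xs) (px ∷ pxs) ¬pi with x ≟ i
... | yes refl = contradiction px ¬pi
... | no _ = mult-outside xs pxs ¬pi

mult-replicate-other : ∀ c {x i} → x ≢ i → mult i (replicate c x) ≡ 0
mult-replicate-other c {x} x≢i = mult-outside {P = _≡ x} (replicate c x) (replicate⁺ c refl) (λ i≡x → x≢i (sym i≡x))

mult>0⇒∈ : ∀ i xs → 1 ≤ mult i xs → i ∈ xs
mult>0⇒∈ i (x ∷ xs) occ with x ≟ i
... | yes x≡i = here (sym x≡i)
... | no _ = there (mult>0⇒∈ i xs occ)

mult-two-valued : ∀ {a b} → a ≢ b → ∀ xs → All (λ y → y ≡ a ⊎ y ≡ b) xs
  → mult a xs + mult b xs ≡ length xs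
mult-two-valued a≢b [] [] = refl
mult-two-valued {a} {b} a≢b (.a ∷ xs) (inj₁ refl ∷ rest) =
  trans (cong₂ _+_ (mult-here a xs) (mult-there xs a≢b)) (cong suc (mult-two-valued a≢b xs rest))
mult-two-valued {a} {b} a≢b (.b ∷ xs) (inj₂ refl ∷ rest) = begin
  mult a (b ∷ xs) + mult b (b ∷ xs)  ≡⟨ cong₂ _+_ (mult-there xs (λ b≡a → a≢b (sym b≡a))) (mult-here b xs) ⟩
  mult a xs + suc (mult b xs)        ≡⟨ +-suc _ _ ⟩
  suc (mult a xs + mult b xs)        ≡⟨ cong suc (mult-two-valued a≢b xs rest) ⟩
  suc (length xs)                    ∎
  where open ≡-Reasoning

head-bounds : ∀ {y ys} → Linked _≥_ (y ∷ ys) → All (_≤ y) (y ∷ ys)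
head-bounds = Linked⇒All (λ y≥z z≥w → ≤-trans z≥w y≥z) ≤-refl

sorted-unique : ∀ xs ys → Linked _≥_ xs → Linked _≥_ ys → (∀ i → mult i xs ≡ mult i ys) → xs ≡ ys
sorted-unique [] [] _ _ _ = refl
sorted-unique [] (y ∷ ys) _ _ same = contradiction (trans (same y) (mult-here y ys)) 0≢1+n
sorted-unique (x ∷ xs) [] _ _ same = contradiction (trans (sym (same x)) (mult-here x xs)) 0≢1+n
sorted-unique (x ∷ xs) (y ∷ ys) xs↘ ys↘ same =
  cong₂ _∷_ x≡y (sorted-unique xs ys (Linked.tail xs↘) (Linked.tail ys↘) same-tail)
  where
  occurs-in : ∀ {u us vs} → (∀ i → mult i (u ∷ us) ≡ mult i vs) → u ∈ vs
  occurs-in {u} {us} {vs} eq = mult>0⇒∈ u vs (subst (1 ≤_) (trans (sym (mult-here u us)) (eq u)) (s≤s z≤n))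
  x≡y : x ≡ y
  x≡y = ≤-antisym (All.lookup (head-bounds ys↘) (occurs-in same))
                  (All.lookup (head-bounds xs↘) (occurs-in (λ i → sym (same i))))
  same-tail : ∀ i → mult i xs ≡ mult i ys
  same-tail i = +-cancelˡ-≡ (mult i (x ∷ [])) _ _ (begin
    mult i (x ∷ []) + mult i xs  ≡⟨ mult-++ i (x ∷ []) xs ⟨
    mult i (x ∷ xs)              ≡⟨ same i ⟩
    mult i (y ∷ ys)              ≡⟨ cong (λ z → mult i (z ∷ ys)) (sym x≡y) ⟩
    mult i (x ∷ ys)              ≡⟨ mult-++ i (x ∷ []) ys ⟩
    mult i (x ∷ []) + mult i ys  ∎)
    where open ≡-Reasoning

sum-replicate : ∀ c y → sum (replicate c y) ≡ c * y
sum-replicate zero y = refl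
sum-replicate (suc c) y = cong (y +_) (sum-replicate c y)

-- weight b ps = Σ_{j < b} j · mult j ps, the contribution of the parts below b to sum ps.
weight : ℕ → List ℕ → ℕ
weight zero ps = 0
weight (suc b) ps = weight b ps + b * mult b ps

weight-[] : ∀ b → weight b [] ≡ 0
weight-[] zero = refl
weight-[] (suc b) = trans (cong (_+ b * 0) (weight-[] b)) (*-zeroʳ b)

weight-∷-≥ : ∀ b {p} ps → b ≤ p → weight b (p ∷ ps) ≡ weight b ps
weight-∷-≥ zero ps _ = refl
weight-∷-≥ (suc b) ps b<p =
  cong₂ _+_ (weight-∷-≥ b ps (<⇒≤ b<p)) (cong (b *_) (mult-there ps (λ p≡b → <⇒≢ b<p (sym p≡b))))

weight-∷-< : ∀ b {p} ps → p < b → weight b (p ∷ ps) ≡ p + weight b ps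
weight-∷-< (suc b) {p} ps (s≤s p≤b) with m≤n⇒m<n∨m≡n p≤b
... | inj₁ p<b = begin
  weight b (p ∷ ps) + b * mult b (p ∷ ps)  ≡⟨ cong₂ _+_ (weight-∷-< b ps p<b) (cong (b *_) (mult-there ps (<⇒≢ p<b))) ⟩
  p + weight b ps + b * mult b ps          ≡⟨ +-assoc p _ _ ⟩
  p + (weight b ps + b * mult b ps)        ∎
  where open ≡-Reasoning
... | inj₂ refl = begin
  weight p (p ∷ ps) + p * mult p (p ∷ ps)  ≡⟨ cong₂ _+_ (weight-∷-≥ p ps ≤-refl) (cong (p *_) (mult-here p ps)) ⟩
  weight p ps + p * suc (mult p ps)        ≡⟨ rearrange (weight p ps) p (mult p ps) ⟩
  p + (weight p ps + p * mult p ps)        ∎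
  where
  open ≡-Reasoning
  rearrange : ∀ w b c → w + b * suc c ≡ b + (w + b * c)
  rearrange = solve-∀

sum≡weight : ∀ b ps → All (_< b) ps → sum ps ≡ weight b ps
sum≡weight b [] [] = sym (weight-[] b)
sum≡weight b (p ∷ ps) (p<b ∷ ps<b) = trans (cong (p +_) (sum≡weight b ps ps<b)) (sym (weight-∷-< b ps p<b))

weight-above : ∀ b ps → All (b ≤_) ps → weight b ps ≡ 0
weight-above b [] [] = weight-[] b
weight-above b (p ∷ ps) (b≤p ∷ b≤ps) = trans (weight-∷-≥ b ps b≤p) (weight-above b ps b≤ps)

rangeSum : ℕ → ℕ → ℕ
rangeSum a zero = 0
rangeSum a (suc n) = rangeSum a n + (a + n)

rangeSum-closed : ∀ a n → 2 * rangeSum a n + n ≡ n * (2 * a + n)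
rangeSum-closed a zero = refl
rangeSum-closed a (suc n) = begin
  2 * (rangeSum a n + (a + n)) + suc n          ≡⟨ regroup (rangeSum a n) a n ⟩
  (2 * rangeSum a n + n) + (2 * a + 2 * n + 1)  ≡⟨ cong (_+ (2 * a + 2 * n + 1)) (rangeSum-closed a n) ⟩
  n * (2 * a + n) + (2 * a + 2 * n + 1)         ≡⟨ expand a n ⟩
  suc n * (2 * a + suc n)                       ∎
  where
  open ≡-Reasoning
  regroup : ∀ T a n → 2 * (T + (a + n)) + suc n ≡ (2 * T + n) + (2 * a + 2 * n + 1)
  regroup = solve-∀
  expand : ∀ a n → n * (2 * a + n) + (2 * a + 2 * n + 1) ≡ suc n * (2 * a + suc n)
  expand = solve-∀

weight-bound : ∀ a n c ps → All (a ≤_) ps → (∀ j → a ≤ j → j < a + n → mult j ps ≤ c)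
  → weight (a + n) ps ≤ c * rangeSum a n
weight-bound a zero c ps a≤ps _ rewrite +-identityʳ a | weight-above a ps a≤ps = z≤n
weight-bound a (suc n) c ps a≤ps few rewrite +-suc a n = begin
  weight (a + n) ps + (a + n) * mult (a + n) ps
    ≤⟨ +-mono-≤ (weight-bound a n c ps a≤ps (λ j a≤j j<a+n → few j a≤j (m<n⇒m<1+n j<a+n)))
                (*-monoʳ-≤ (a + n) (few (a + n) (m≤m+n a n) ≤-refl)) ⟩
  c * rangeSum a n + (a + n) * c  ≡⟨ cong (c * rangeSum a n +_) (*-comm (a + n) c) ⟩
  c * rangeSum a n + c * (a + n)  ≡⟨ *-distribˡ-+ c (rangeSum a n) (a + n) ⟨
  c * (rangeSum a n + (a + n))    ∎
  where open ≤-Reasoning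

sum-bounded-multiplicity : ∀ a n c ps → All (λ p → a ≤ p × p < a + n) ps
  → (∀ j → a ≤ j → j < a + n → mult j ps ≤ c) → sum ps ≤ c * rangeSum a n
sum-bounded-multiplicity a n c ps range few = begin
  sum ps               ≡⟨ sum≡weight (a + n) ps (All.map proj₂ range) ⟩
  weight (a + n) ps    ≤⟨ weight-bound a n c ps (All.map proj₁ range) few ⟩
  c * rangeSum a n     ∎
  where open ≤-Reasoning

-- Packing units of s into parts 2s and 3s.

Coin : ℕ → ℕ → Set
Coin s y = y ≡ 2 * s ⊎ y ≡ 3 * s

pack : ℕ → ℕ → List ℕ
pack s zero = 2 * s ∷ []
pack s (suc zero) = 3 * s ∷ []
pack s (suc (suc m)) = 2 * s ∷ pack s m

pack-sum : ∀ s m → sum (pack s m) ≡ (2 + m) * s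
pack-sum s zero = +-identityʳ (2 * s)
pack-sum s (suc zero) = +-identityʳ (3 * s)
pack-sum s (suc (suc m)) = trans (cong (2 * s +_) (pack-sum s m)) (add-2s s m)
  where
  add-2s : ∀ s m → 2 * s + (2 + m) * s ≡ (4 + m) * s
  add-2s = solve-∀

pack-coins : ∀ s m → All (Coin s) (pack s m)
pack-coins s zero = inj₁ refl ∷ []
pack-coins s (suc zero) = inj₂ refl ∷ []
pack-coins s (suc (suc m)) = inj₁ refl ∷ pack-coins s m

pack-nonempty : ∀ s m → 1 ≤ length (pack s m)
pack-nonempty s zero = s≤s z≤n
pack-nonempty s (suc zero) = s≤s z≤n
pack-nonempty s (suc (suc m)) = s≤s z≤n

block : ℕ → ℕ → List ℕ
block s m = pack s (2 + m)

block-count : ∀ s m → 2 * s ≢ 3 * s → 2 ≤ mult (2 * s) (block s m) + mult (3 * s) (block s m)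
block-count s m 2s≢3s =
  subst (2 ≤_) (sym (mult-two-valued 2s≢3s (block s m) (pack-coins s (2 + m)))) (s≤s (pack-nonempty s m))

-- Arithmetic attached to s = t + 1 (writing s as a successor makes s ∸ 1 = t).

≤-by-difference : ∀ {a b} d → a + d ≡ b → a ≤ b
≤-by-difference {a} d refl = m≤m+n a d

module Size (t : ℕ) where

  s : ℕ
  s = suc t

  -- The lower bound N = 2s² + 5s for the largest part of a partition in C³.
  N : ℕ
  N = 2 * s ^ 2 + 5 * s

  s<2s : s < 2 * s
  s<2s = m<m+n s (s≤s z≤n)

  2s<3s : 2 * s < 3 * s
  2s<3s = m<n+m (2 * s) (s≤s z≤n)

  2s≤N : 2 * s ≤ N
  2s≤N = ≤-trans (*-monoˡ-≤ s {2} {5} (s≤s (s≤s z≤n))) (m≤n+m (5 * s) (2 * s ^ 2))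

  N-factor : N ≡ (2 * s + 5) * s
  N-factor = identity t
    where
    identity : ∀ t → 2 * (suc t * (suc t * 1)) + 5 * suc t ≡ (2 * suc t + 5) * suc t
    identity = solve-∀

  -- The values strictly between s and N are the len values from s + 1 on.
  len : ℕ
  len = 2 * t * t + 8 * t + 5

  range-end : suc s + len ≡ N
  range-end = identity t
    where
    identity : ∀ t → suc (suc t) + (2 * t * t + 8 * t + 5) ≡ 2 * (suc t * (suc t * 1)) + 5 * suc t
    identity = solve-∀

  -- The lower bound on n in the theorem, shifted by 14s² to avoid truncated subtraction.
  R : ℕ
  R = 2 * s ^ 5 + 8 * s ^ 4 + s ^ 3 + 3 * s

  small-sum : t * rangeSum (suc s) len + 14 * s ^ 2 ≡ R
  small-sum = *-cancelˡ-≡ _ _ 2 (+-cancelʳ-≡ (t * len) _ _ (begin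
    2 * (t * T + 14 * s ^ 2) + t * len          ≡⟨ regroup t T ⟩
    t * (2 * T + len) + 28 * s ^ 2              ≡⟨ cong (λ z → t * z + 28 * s ^ 2) (rangeSum-closed (suc s) len) ⟩
    t * (len * (2 * suc s + len)) + 28 * s ^ 2  ≡⟨ expand t ⟩
    2 * R + t * len                             ∎))
    where
    open ≡-Reasoning
    T : ℕ
    T = rangeSum (suc s) len
    regroup : ∀ t T → 2 * (t * T + 14 * (suc t * (suc t * 1))) + t * (2 * t * t + 8 * t + 5)
                      ≡ t * (2 * T + (2 * t * t + 8 * t + 5)) + 28 * (suc t * (suc t * 1))
    regroup = solve-∀
    expand : ∀ t → t * ((2 * t * t + 8 * t + 5) * (2 * suc (suc t) + (2 * t * t + 8 * t + 5)))
                     + 28 * (suc t * (suc t * 1))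
                   ≡ 2 * (2 * (suc t * (suc t * (suc t * (suc t * (suc t * 1)))))
                          + 8 * (suc t * (suc t * (suc t * (suc t * 1))))
                          + suc t * (suc t * (suc t * 1)) + 3 * suc t)
                     + t * (2 * t * t + 8 * t + 5)
    expand = solve-∀

  no-small-partition : ∀ {n} ps → sum ps ≡ n → All (suc s ≤_) ps
    → (∀ j → suc s ≤ j → j ≤ N ∸ 1 → mult j ps ≤ s ∸ 1)
    → R + 1 ≤ n + 14 * s ^ 2 → ¬ All (_< N) ps
  no-small-partition {n} ps sum≡n s<ps few n-large ps<N = m+1+n≰m R (≤-trans n-large bound)
    where
    range : All (λ p → suc s ≤ p × p < suc s + len) ps
    range = All.zip (s<ps , All.map (λ {p} → subst (p <_) (sym range-end)) ps<N)
    few-in-range : ∀ j → suc s ≤ j → j < suc s + len → mult j ps ≤ t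
    few-in-range j s<j j<end = few j s<j (<⇒≤pred (subst (j <_) range-end j<end))
    bound : n + 14 * s ^ 2 ≤ R
    bound = begin
      n + 14 * s ^ 2                         ≡⟨ cong (_+ 14 * s ^ 2) sum≡n ⟨
      sum ps + 14 * s ^ 2                    ≤⟨ +-monoˡ-≤ _ (sum-bounded-multiplicity (suc s) len t ps range few-in-range) ⟩
      t * rangeSum (suc s) len + 14 * s ^ 2  ≡⟨ small-sum ⟩
      R                                      ∎
      where open ≤-Reasoning

  -- For a part p ≥ N: the repeated part x p = s + (p mod s) and the number m p of
  -- further units of s, so that p = s + (s + 1)·x p + (4 + m p)·s.
  x : ℕ → ℕ
  x p = s + p % s

  m : ℕ → ℕ
  m p = p / s ∸ (6 + s + p % s)

  quotient-large : ∀ p → N ≤ p → 2 * s + 5 ≤ p / s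
  quotient-large p N≤p = ≤-pred (*-cancelʳ-< s _ _ (begin-strict
    (2 * s + 5) * s          ≡⟨ N-factor ⟨
    N                        ≤⟨ N≤p ⟩
    p                        ≡⟨ m≡m%n+[m/n]*n p s ⟩
    p % s + p / s * s        <⟨ +-monoˡ-< (p / s * s) (m%n<n p s) ⟩
    s + p / s * s            ∎))
    where open ≤-Reasoning

  decompose : ∀ p → N ≤ p → s + suc s * x p + (4 + m p) * s ≡ p
  decompose p N≤p = begin
    s + suc s * (s + p % s) + (4 + m p) * s   ≡⟨ regroup s (p % s) (m p) ⟩
    p % s + ((6 + s + p % s) + m p) * s       ≡⟨ cong (λ z → p % s + z * s) (m+[n∸m]≡n offset≤quotient) ⟩
    p % s + p / s * s                         ≡⟨ m≡m%n+[m/n]*n p s ⟨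
    p                                         ∎
    where
    open ≡-Reasoning
    regroup : ∀ s r m → s + suc s * (s + r) + (4 + m) * s ≡ r + ((6 + s + r) + m) * s
    regroup = solve-∀
    offset : ∀ t → 6 + suc t + t ≡ 2 * suc t + 5
    offset = solve-∀
    offset≤quotient : 6 + s + p % s ≤ p / s
    offset≤quotient = ≤-trans (+-monoʳ-≤ (6 + s) (≤-pred (m%n<n p s)))
                              (≤-trans (≤-reflexive (offset t)) (quotient-large p N≤p))

  -- If moreover p is not of the form a·s with a ≥ 2, then s ∤ p, so s < x p.
  s<x : ∀ p → N ≤ p → (∀ a → 2 ≤ a → p ≢ a * s) → s < x p
  s<x p N≤p not-multiple with p % s ≟ 0
  ... | no r≢0 = m<m+n s (n≢0⇒n>0 r≢0)
  ... | yes r≡0 = contradiction multiple (not-multiple (p / s) 2≤quotient)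
    where
    multiple : p ≡ p / s * s
    multiple = trans (m≡m%n+[m/n]*n p s) (cong (λ r → r + p / s * s) r≡0)
    2≤quotient : 2 ≤ p / s
    2≤quotient = ≤-trans (≤-trans (s≤s (s≤s z≤n)) (m≤n+m 5 (2 * s))) (quotient-large p N≤p)

  s-not-coin : ¬ Coin s s
  s-not-coin = [ <⇒≢ s<2s , <⇒≢ (<-trans s<2s 2s<3s) ]

  x<2s : ∀ p → x p < 2 * s
  x<2s p = ≤-trans (+-monoʳ-< s (m%n<n p s)) (≤-reflexive (cong (s +_) (sym (+-identityʳ s))))

module Phi3 (t L k n : ℕ)
    (L-large : 2 * suc t ^ 3 + 5 * suc t ^ 2 + 1 ≤ L) (L≤k : L ≤ k)
    (n-large : 2 * suc t ^ 5 + 8 * suc t ^ 4 + suc t ^ 3 + 3 * suc t + 1 ≤ n + 14 * suc t ^ 2) where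

  open Size t

  -- L is large enough that the parts s, …, 3s of a gadget (below) stay below k.
  3s<L : 3 * s < L
  3s<L = ≤-trans (≤-by-difference (2 * s ^ 3 + 5 * t * t + 7 * t + 2) (identity t)) L-large
    where
    identity : ∀ t → suc (3 * suc t) + (2 * (suc t * (suc t * (suc t * 1))) + 5 * t * t + 7 * t + 2)
                     ≡ 2 * (suc t * (suc t * (suc t * 1))) + 5 * (suc t * (suc t * 1)) + 1
    identity = solve-∀

  -- The parts replacing the largest part p: s + 1 copies of x p, one part s and a
  -- block of parts 2s and 3s.  All of them lie in [s, 3s], hence below k.
  gadget : ℕ → List ℕ
  gadget p = replicate (suc s) (x p) ++ (s ∷ block s (m p))

  gadget-sum : ∀ p → N ≤ p → sum (gadget p) ≡ p
  gadget-sum p N≤p = begin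
    sum (gadget p)                                             ≡⟨ sum-++ (replicate (suc s) (x p)) _ ⟩
    sum (replicate (suc s) (x p)) + (s + sum (block s (m p)))  ≡⟨ cong₂ (λ a b → a + (s + b)) (sum-replicate (suc s) (x p)) (pack-sum s (2 + m p)) ⟩
    suc s * x p + (s + (4 + m p) * s)                          ≡⟨ regroup (suc s * x p) s ((4 + m p) * s) ⟩
    s + suc s * x p + (4 + m p) * s                            ≡⟨ decompose p N≤p ⟩
    p                                                          ∎
    where
    open ≡-Reasoning
    regroup : ∀ a b c → a + (b + c) ≡ b + a + c
    regroup = solve-∀

  gadget-bounds : ∀ p → All (λ y → s ≤ y × y ≤ 3 * s) (gadget p)
  gadget-bounds p = ++⁺ (replicate⁺ (suc s) (m≤m+n s (p % s) , <⇒≤ (<-trans (x<2s p) 2s<3s)))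
                        ((≤-refl , <⇒≤ (<-trans s<2s 2s<3s)) ∷ All.map coin-bounds (pack-coins s (2 + m p)))
    where
    coin-bounds : ∀ {y} → Coin s y → s ≤ y × y ≤ 3 * s
    coin-bounds (inj₁ refl) = <⇒≤ s<2s , <⇒≤ 2s<3s
    coin-bounds (inj₂ refl) = <⇒≤ (<-trans s<2s 2s<3s) , ≤-refl

  -- The values s, 2s and 3s: the only ones used by the part s ∷ block of a gadget.
  Special : ℕ → Set
  Special i = i ≡ s ⊎ Coin s i

  special? : ∀ i → Dec (Special i)
  special? i = i ≟ s ⊎-dec (i ≟ 2 * s ⊎-dec i ≟ 3 * s)

  x-ordinary : ∀ p → s < x p → ¬ Special (x p)
  x-ordinary p s<x = [ >⇒≢ s<x , [ <⇒≢ (x<2s p) , <⇒≢ (<-trans (x<2s p) 2s<3s) ] ]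

  mult-gadget-ordinary : ∀ i p → ¬ Special i → mult i (gadget p) ≡ mult i (replicate (suc s) (x p))
  mult-gadget-ordinary i p ordinary = begin
    mult i (gadget p)                                                    ≡⟨ mult-++ i (replicate (suc s) (x p)) _ ⟩
    mult i (replicate (suc s) (x p)) + mult i (s ∷ block s (m p))       ≡⟨ cong (mult i (replicate (suc s) (x p)) +_) special-free ⟩
    mult i (replicate (suc s) (x p)) + 0                                 ≡⟨ +-identityʳ _ ⟩
    mult i (replicate (suc s) (x p))                                     ∎
    where
    open ≡-Reasoning
    special-free : mult i (s ∷ block s (m p)) ≡ 0
    special-free = mult-outside {P = Special} (s ∷ block s (m p))
                     (inj₁ refl ∷ All.map inj₂ (pack-coins s (2 + m p))) ordinary

  φ-list : ℕ → List ℕ → List ℕ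
  φ-list p rest = sort (rest ++ gadget p)

  mult-φ-list : ∀ i p rest → mult i (φ-list p rest) ≡ mult i rest + mult i (gadget p)
  mult-φ-list i p rest = trans (mult-↭ i (sort-↭ (rest ++ gadget p))) (mult-++ i rest (gadget p))

  C3-nonempty : IsPartition n [] → InC3 L s k [] → ⊥
  C3-nonempty (_ , _ , sum≡n) (_ , _ , _ , few) = no-small-partition [] sum≡n [] few n-large []

  largest-part-large : ∀ {p rest} → IsPartition n (p ∷ rest) → InC3 L s k (p ∷ rest) → N ≤ p
  largest-part-large {p} {rest} (sorted , _ , sum≡n) (inC , _ , _ , few) with N ≤? p
  ... | yes N≤p = N≤p
  ... | no N≰p = contradiction (All.map (λ y≤p → ≤-<-trans y≤p (≰⇒> N≰p)) (head-bounds sorted))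
                   (no-small-partition (p ∷ rest) sum≡n (All.map proj₁ inC) few n-large)

  module Summand {p rest} (part : IsPartition n (p ∷ rest)) (c3 : InC3 L s k (p ∷ rest)) where

    p-large : N ≤ p
    p-large = largest-part-large part c3

    x-large : s < x p
    x-large = s<x p p-large (λ a 2≤a → mult-zero-head rest (proj₁ (proj₂ (proj₂ c3)) a 2≤a))

    rest-bounds : All (λ y → suc s ≤ y × y ≤ s + L) rest
    rest-bounds = All.tail (proj₁ c3)

    rest-avoids-special : ∀ i → Special i → mult i rest ≡ 0
    rest-avoids-special i (inj₁ refl) = mult-outside rest rest-bounds (λ (s<s , _) → <-irrefl refl s<s)
    rest-avoids-special i (inj₂ (inj₁ refl)) = mult-zero-tail p rest (proj₁ (proj₂ (proj₂ c3)) 2 (s≤s (s≤s z≤n)))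
    rest-avoids-special i (inj₂ (inj₂ refl)) = mult-zero-tail p rest (proj₁ (proj₂ (proj₂ c3)) 3 (s≤s (s≤s z≤n)))

    rest-few : ∀ j → s < j → j < N → mult j rest ≤ t
    rest-few j s<j j<N = ≤-trans (mult-∷-≤ j p rest) (proj₂ (proj₂ (proj₂ c3)) j s<j (<⇒≤pred j<N))

    image : List ℕ
    image = φ-list p rest

    image-bounds : All (λ y → s ≤ y × y ≤ s + L) image
    image-bounds = All-resp-↭ (↭-sym (sort-↭ (rest ++ gadget p)))
                     (++⁺ (All.map (λ (s<y , y≤s+L) → <⇒≤ s<y , y≤s+L) rest-bounds)
                          (All.map (λ (s≤y , y≤3s) → s≤y , ≤-trans y≤3s 3s≤s+L) (gadget-bounds p)))
      where
      3s≤s+L : 3 * s ≤ s + L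
      3s≤s+L = ≤-trans (<⇒≤ 3s<L) (m≤n+m L s)

    image-sum : sum image ≡ n
    image-sum = begin
      sum image                     ≡⟨ sum-↭ (sort-↭ (rest ++ gadget p)) ⟩
      sum (rest ++ gadget p)        ≡⟨ sum-++ rest (gadget p) ⟩
      sum rest + sum (gadget p)     ≡⟨ cong (sum rest +_) (gadget-sum p p-large) ⟩
      sum rest + p                  ≡⟨ +-comm (sum rest) p ⟩
      p + sum rest                  ≡⟨ proj₂ (proj₂ part) ⟩
      n                             ∎
      where open ≡-Reasoning

    image-partition : IsPartition n image
    image-partition = sort-↗ (rest ++ gadget p)
                    , All.map (λ (s≤y , _) → ≤-trans (s≤s z≤n) s≤y) image-bounds
                    , image-sum

    image-no-k : mult k image ≡ 0
    image-no-k = trans (mult-φ-list k p rest)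
                   (cong₂ _+_ (mult-zero-tail p rest (proj₁ (proj₂ c3)))
                              (mult-outside (gadget p) (gadget-bounds p) (λ (_ , k≤3s) → <⇒≱ 3s<k k≤3s)))
      where
      3s<k : 3 * s < k
      3s<k = <-≤-trans 3s<L L≤k

    image-one-s : mult s image ≡ 1
    image-one-s = begin
      mult s image                                                    ≡⟨ mult-φ-list s p rest ⟩
      mult s rest + mult s (gadget p)                                 ≡⟨ cong (_+ mult s (gadget p)) (rest-avoids-special s (inj₁ refl)) ⟩
      mult s (gadget p)                                               ≡⟨ mult-++ s (replicate (suc s) (x p)) _ ⟩
      mult s (replicate (suc s) (x p)) + mult s (s ∷ block s (m p))   ≡⟨ cong₂ _+_ (mult-replicate-other (suc s) (>⇒≢ x-large)) (mult-here s _) ⟩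
      suc (mult s (block s (m p)))                                    ≡⟨ cong suc (mult-outside (block s (m p)) (pack-coins s (2 + m p)) s-not-coin) ⟩
      1                                                               ∎
      where open ≡-Reasoning

    block-≤-image : ∀ i → mult i (block s (m p)) ≤ mult i image
    block-≤-image i = begin
      mult i (block s (m p))                                      ≤⟨ mult-∷-≤ i s _ ⟩
      mult i (s ∷ block s (m p))                                  ≤⟨ m≤n+m _ _ ⟩
      mult i (replicate (suc s) (x p)) + mult i (s ∷ block s (m p)) ≡⟨ mult-++ i (replicate (suc s) (x p)) _ ⟨
      mult i (gadget p)                                           ≤⟨ m≤n+m _ _ ⟩
      mult i rest + mult i (gadget p)                             ≡⟨ mult-φ-list i p rest ⟨
      mult i image                                                ∎
      where open ≤-Reasoning

    image-in-F3 : IsPartition n image × InF3 L s k image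
    image-in-F3 = image-partition
                , ( (mult>0⇒∈ s image (≤-reflexive (sym image-one-s)) , image-bounds , image-no-k)
                  , image-one-s
                  , ≤-trans (block-count s (m p) (<⇒≢ 2s<3s))
                            (+-mono-≤ (block-≤-image (2 * s)) (block-≤-image (3 * s))))

  -- φ₃ is injective on C³: the repeated part x p is the only value that occurs s + 1
  -- times in the image, the remainder then agrees in every multiplicity, and p is
  -- fixed by the total n.
  φ-list-injective : ∀ {p₁ r₁ p₂ r₂}
    → (part₁ : IsPartition n (p₁ ∷ r₁)) → InC3 L s k (p₁ ∷ r₁)
    → (part₂ : IsPartition n (p₂ ∷ r₂)) → InC3 L s k (p₂ ∷ r₂)
    → φ-list p₁ r₁ ≡ φ-list p₂ r₂ → p₁ ∷ r₁ ≡ p₂ ∷ r₂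
  φ-list-injective {p₁} {r₁} {p₂} {r₂} part₁ c₁ part₂ c₂ same = cong₂ _∷_ p₁≡p₂ r₁≡r₂
    where
    module S₁ = Summand part₁ c₁
    module S₂ = Summand part₂ c₂

    same-mult : ∀ i → mult i r₁ + mult i (gadget p₁) ≡ mult i r₂ + mult i (gadget p₂)
    same-mult i = trans (sym (mult-φ-list i p₁ r₁)) (trans (cong (mult i) same) (mult-φ-list i p₂ r₂))

    -- If x p₂ ≠ x p₁, the s + 1 copies of x p₁ would have to come from r₂.
    too-many : x p₂ ≢ x p₁ → suc s ≤ t
    too-many x₂≢x₁ = begin
      suc s                                        ≡⟨ mult-replicate (suc s) y ⟨
      mult y (replicate (suc s) y)                 ≡⟨ mult-gadget-ordinary y p₁ y-ordinary ⟨
      mult y (gadget p₁)                           ≤⟨ m≤n+m _ _ ⟩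
      mult y r₁ + mult y (gadget p₁)               ≡⟨ same-mult y ⟩
      mult y r₂ + mult y (gadget p₂)               ≡⟨ cong (mult y r₂ +_) (mult-gadget-ordinary y p₂ y-ordinary) ⟩
      mult y r₂ + mult y (replicate (suc s) (x p₂)) ≡⟨ cong (mult y r₂ +_) (mult-replicate-other (suc s) x₂≢x₁) ⟩
      mult y r₂ + 0                                ≡⟨ +-identityʳ _ ⟩
      mult y r₂                                    ≤⟨ S₂.rest-few y S₁.x-large (<-≤-trans (x<2s p₁) 2s≤N) ⟩
      t                                            ∎
      where
      open ≤-Reasoning
      y : ℕ
      y = x p₁
      y-ordinary : ¬ Special y
      y-ordinary = x-ordinary p₁ S₁.x-large

    x₁≡x₂ : x p₁ ≡ x p₂
    x₁≡x₂ with x p₁ ≟ x p₂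
    ... | yes x₁≡x₂ = x₁≡x₂
    ... | no x₁≢x₂ = contradiction (≤-trans (n≤1+n (suc t)) (too-many (λ x₂≡x₁ → x₁≢x₂ (sym x₂≡x₁)))) (n≮n t)

    same-rest : ∀ i → mult i r₁ ≡ mult i r₂
    same-rest i with special? i
    ... | yes special = trans (S₁.rest-avoids-special i special) (sym (S₂.rest-avoids-special i special))
    ... | no ordinary = +-cancelʳ-≡ (mult i (replicate (suc s) (x p₂))) _ _ (begin
      mult i r₁ + mult i (replicate (suc s) (x p₂))  ≡⟨ cong (λ z → mult i r₁ + mult i (replicate (suc s) z)) x₁≡x₂ ⟨
      mult i r₁ + mult i (replicate (suc s) (x p₁))  ≡⟨ cong (mult i r₁ +_) (mult-gadget-ordinary i p₁ ordinary) ⟨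
      mult i r₁ + mult i (gadget p₁)                 ≡⟨ same-mult i ⟩
      mult i r₂ + mult i (gadget p₂)                 ≡⟨ cong (mult i r₂ +_) (mult-gadget-ordinary i p₂ ordinary) ⟩
      mult i r₂ + mult i (replicate (suc s) (x p₂))  ∎)
      where open ≡-Reasoning

    r₁≡r₂ : r₁ ≡ r₂
    r₁≡r₂ = sorted-unique r₁ r₂ (Linked.tail (proj₁ part₁)) (Linked.tail (proj₁ part₂)) same-rest

    p₁≡p₂ : p₁ ≡ p₂
    p₁≡p₂ = +-cancelʳ-≡ (sum r₂) p₁ p₂
              (trans (cong (λ r → p₁ + sum r) (sym r₁≡r₂)) (trans (proj₂ (proj₂ part₁)) (sym (proj₂ (proj₂ part₂)))))

  φ : C3 L s k n → F3 L s k n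
  φ ([] , part , c3) = ⊥-elim (C3-nonempty part c3)
  φ (p ∷ rest , part , c3) = φ-list p rest , Summand.image-in-F3 part c3

  φ-injective : ∀ a b → proj₁ (φ a) ≡ proj₁ (φ b) → proj₁ a ≡ proj₁ b
  φ-injective ([] , part , c3) _ _ = ⊥-elim (C3-nonempty part c3)
  φ-injective (_ ∷ _ , _) ([] , part , c3) _ = ⊥-elim (C3-nonempty part c3)
  φ-injective (p₁ ∷ r₁ , part₁ , c₁) (p₂ ∷ r₂ , part₂ , c₂) same = φ-list-injective part₁ c₁ part₂ c₂ same

-- Lemma 2.5.
lemma2p5 : (s L k n : ℕ) → 1 ≤ s → 2 * s ^ 3 + 5 * s ^ 2 + 1 ≤ L → L ≤ k → k ≤ s + L
    → 2 * s ^ 5 + 8 * s ^ 4 + s ^ 3 + 3 * s + 1 ≤ n + 14 * s ^ 2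
    → Injection {C3 L s k n} {F3 L s k n} proj₁ proj₁
lemma2p5 (suc t) L k n _ L-large L≤k _ n-large = φ , φ-injective
  where open Phi3 t L k n L-large L≤k n-large
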